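{- Let $G=(V,E)$ be a finite, simple, undirected, unweighted graph, let $h$ be a positive integer, let $v\in V$, and let $u\in N_v^h(G)$ with $s=dis_G(u,v)$. Define $$F_u=\{w : w\in N_v^{h-s}(G),\ dis_{G(V\setminus\{v\})}(u,w)>h\}.$$ Then $N_u^h(G)\setminus N_u^h\bigl(G(V\setminus\{v\})\bigr)=\{v\}\cup F_u$.
   Context: For $S\subseteq V$, $G(S)$ denotes the subgraph of $G$ induced by $S$. For a graph $H$ and vertices $x,y$ of $H$, $dis_H(x,y)$ is the shortest-path distance between $x$ and $y$ in $H$ (equal to $+\infty$ if no path exists). For a graph $H$ with vertex set $W$, a vertex $x\in W$ and a nonnegative integer $t$, the $t$-hop neighborhood of $x$ in $H$ is $N_x^{t}(H)=\{y\in W : y\neq x,\ dis_H(x,y)\le t\}$ (so $N_x^0(H)=\emptyset$). -}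

module Defs where

open import Level using (0ℓ)
open import Data.Nat using (ℕ; zero; suc; _≤_; _<_; _∸_)
open import Data.Fin using (Fin)
open import Data.Product using (Σ; _×_)
open import Relation.Nullary using (¬_)
open import Relation.Binary.PropositionalEquality using (_≡_; _≢_)
open import Relation.Unary using (Pred; _∈_; U; ∁; ｛_｝)

-- A finite simple undirected unweighted graph on vertex set Fin n:
-- a symmetric, irreflexive adjacency relation (no loops; at most one
-- edge between two vertices since edges are given by a relation).
record SimpleGraph (n : ℕ) : Set₁ where
  field
    Adj    : Fin n → Fin n → Set
    sym    : ∀ {x y} → Adj x y → Adj y x
    irrefl : ∀ {x} → ¬ Adj x x

module _ {n : ℕ} (G : SimpleGraph n) where
  open SimpleGraph G

  -- Walks of length k from x to y in the induced subgraph G(S):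
  -- every vertex of the walk lies in S, consecutive vertices adjacent in G.
  data Walk (S : Pred (Fin n) 0ℓ) : Fin n → Fin n → ℕ → Set where
    stop : ∀ {x} → x ∈ S → Walk S x x zero
    step : ∀ {x y z k} → x ∈ S → Adj x y → Walk S y z k → Walk S x z (suc k)

  -- dis_{G(S)}(x,y) ≤ t  (shortest-path distance; +∞ if no path)
  DisLe : Pred (Fin n) 0ℓ → Fin n → Fin n → ℕ → Set
  DisLe S x y t = Σ ℕ (λ k → k ≤ t × Walk S x y k)

  IsDis : Pred (Fin n) 0ℓ → Fin n → Fin n → ℕ → Set
  IsDis S x y d = Walk S x y d × (∀ k → k < d → ¬ Walk S x y k)

  -- dis_{G(S)}(x,y) > t  (includes the case dis = +∞)
  DisGt : Pred (Fin n) 0ℓ → Fin n → Fin n → ℕ → Set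
  DisGt S x y t = ¬ DisLe S x y t

  Nbhd : Pred (Fin n) 0ℓ → Fin n → ℕ → Pred (Fin n) 0ℓ
  Nbhd S x t y = y ∈ S × y ≢ x × DisLe S x y t

  Minus : Fin n → Pred (Fin n) 0ℓ
  Minus v = ∁ ｛ v ｝

  F : ℕ → Fin n → Fin n → ℕ → Pred (Fin n) 0ℓ
  F h v u s w = w ∈ Nbhd U v (h ∸ s) × DisGt (Minus v) u w h

module Submission where

-- The theorem is then the conjunction of two inclusions:
--  * a vertex w ≠ v lost from N_u^h has every walk from u of length ≤ h
--    pass through v; splitting one, the part before v has length ≥ s,
--    so the part from v to w has length ≤ h - s, i.e. w ∈ F_u;
--  * conversely v is lost (it is at distance s ≤ h in G and is not a
--    vertex of G - v), and each w ∈ F_u is reached as u ⇝ v ⇝ w in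
--    s + (h - s) ≤ h steps, while F_u excludes w from N_u^h(G - v).

open import Defs
open import Data.Nat using (ℕ; suc; _≤_; _+_; _∸_; z≤n)
open import Data.Nat.Properties
  using (_≤?_; ≰⇒>; ≤-trans; +-comm; +-monoʳ-≤; m+n≤o⇒m≤o∸n; m≤o∸n⇒m+n≤o)
open import Data.Fin using (Fin; _≟_)
open import Data.Product using (Σ; _×_; _,_; proj₁)
open import Data.Sum using (_⊎_; inj₁; inj₂)
open import Data.Unit using (tt)
open import Data.Empty using (⊥-elim)
open import Relation.Nullary using (yes; no)
open import Relation.Binary.PropositionalEquality using (_≡_; _≢_; refl; sym; cong; subst)
open import Relation.Unary using (Pred; _∈_; U; ｛_｝; _∪_; _∖_; _≐_)
open import Level using (0ℓ)

tail-within-budget : ∀ {s a b h} → s ≤ a → a + b ≤ h → b ≤ h ∸ s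
tail-within-budget {s} {a} {b} {h} s≤a a+b≤h =
  m+n≤o⇒m≤o∸n b (≤-trans (+-monoʳ-≤ b s≤a) (subst (_≤ h) (+-comm a b) a+b≤h))

detour-within-budget : ∀ {s b h} → s ≤ h → b ≤ h ∸ s → s + b ≤ h
detour-within-budget {s} {b} {h} s≤h b≤h∸s =
  subst (_≤ h) (+-comm b s) (m≤o∸n⇒m+n≤o b s≤h b≤h∸s)

module Walks {n : ℕ} (G : SimpleGraph n) where
  open SimpleGraph G using (Adj) renaming (sym to adj-sym)

  snoc : ∀ {S x y z k} → Walk G S x y k → z ∈ S → Adj y z → Walk G S x z (suc k)
  snoc (stop x∈S)     z∈S a = step x∈S a (stop z∈S)
  snoc (step x∈S a w) z∈S b = step x∈S a (snoc w z∈S b)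

  reverse : ∀ {S x y k} → Walk G S x y k → Walk G S y x k
  reverse (stop x∈S)     = stop x∈S
  reverse (step x∈S a w) = snoc (reverse w) x∈S (adj-sym a)

  append : ∀ {S x y z a b} → Walk G S x y a → Walk G S y z b → Walk G S x z (a + b)
  append (stop _)       w′ = w′
  append (step x∈S a w) w′ = step x∈S a (append w w′)

  dis-≤-walk : ∀ {S x y d k} → IsDis G S x y d → Walk G S x y k → d ≤ k
  dis-≤-walk {d = d} {k} (_ , no-shorter) w with d ≤? k
  ... | yes d≤k = d≤k
  ... | no  d≰k = ⊥-elim (no-shorter k (≰⇒> d≰k) w)

  Through : Fin n → Fin n → Fin n → ℕ → Set
  Through v x y k =
    Σ ℕ λ a → Σ ℕ λ b → (a + b ≡ k) × Walk G U x v a × Walk G U v y b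

  avoids-or-through : ∀ v {x y k} → Walk G U x y k →
                      Walk G (Minus G v) x y k ⊎ Through v x y k
  avoids-or-through v {x} (stop _) with v ≟ x
  ... | yes refl = inj₂ (0 , 0 , refl , stop tt , stop tt)
  ... | no  v≢x  = inj₁ (stop v≢x)
  avoids-or-through v {x} (step {k = k} _ a w) with v ≟ x
  ... | yes refl = inj₂ (0 , suc k , refl , stop tt , step tt a w)
  ... | no  v≢x  with avoids-or-through v w
  ...   | inj₁ w-v = inj₁ (step v≢x a w-v)
  ...   | inj₂ (a′ , b , a′+b≡k , to-v , from-v) =
          inj₂ (suc a′ , b , cong suc a′+b≡k , step tt a to-v , from-v)

module RemovedNeighbourhood {n : ℕ} (G : SimpleGraph n) (h : ℕ) (v u : Fin n) (s : ℕ)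
                            (dis-uv : IsDis G U u v s) where
  open Walks G

  Lost : Pred (Fin n) 0ℓ
  Lost = Nbhd G U u h ∖ Nbhd G (Minus G v) u h

  lost⊆ : ∀ {w} → w ∈ Lost → w ∈ (｛ v ｝ ∪ F G h v u s)
  lost⊆ {w} ((_ , w≢u , m , m≤h , u⇝w) , not-in-G-v) with v ≟ w
  ... | yes v≡w = inj₁ v≡w
  ... | no  v≢w = inj₂ ((tt , (λ w≡v → v≢w (sym w≡v)) , b≤h∸s) , far-in-G-v)
    where
      far-in-G-v : DisGt G (Minus G v) u w h
      far-in-G-v close = not-in-G-v (v≢w , w≢u , close)

      b≤h∸s : DisLe G U v w (h ∸ s)
      b≤h∸s with avoids-or-through v u⇝w
      ... | inj₁ u⇝w-v = ⊥-elim (far-in-G-v (m , m≤h , u⇝w-v))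
      ... | inj₂ (a , b , a+b≡m , u⇝v , v⇝w) =
            b , tail-within-budget (dis-≤-walk dis-uv u⇝v) (subst (_≤ h) (sym a+b≡m) m≤h) , v⇝w

  ⊆lost : u ≢ v → s ≤ h → ∀ {w} → w ∈ (｛ v ｝ ∪ F G h v u s) → w ∈ Lost
  ⊆lost u≢v s≤h (inj₁ refl) =
    (tt , (λ v≡u → u≢v (sym v≡u)) , s , s≤h , proj₁ dis-uv) , λ { (v≢v , _) → v≢v refl }
  ⊆lost u≢v s≤h {w} (inj₂ ((_ , _ , b , b≤h∸s , v⇝w) , far-in-G-v)) =
    (tt , w≢u , s + b , detour-within-budget s≤h b≤h∸s , append (proj₁ dis-uv) v⇝w) ,
    λ { (_ , _ , close) → far-in-G-v close }
    where
      -- u itself is at distance 0 from u in G - v, so it is not in F_u.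
      w≢u : w ≢ u
      w≢u refl = far-in-G-v (0 , z≤n , stop (λ v≡u → u≢v (sym v≡u)))

mainTheorem3 : ∀ {n : ℕ} (G : SimpleGraph n) (h : ℕ) → 1 ≤ h →
    (v u : Fin n) → u ∈ Nbhd G U v h →
    (s : ℕ) → IsDis G U u v s →
    (Nbhd G U u h ∖ Nbhd G (Minus G v) u h) ≐ (｛ v ｝ ∪ F G h v u s)
mainTheorem3 G h _ v u (_ , u≢v , k , k≤h , v⇝u) s dis-uv =
  lost⊆ , ⊆lost u≢v s≤h
  where
    open Walks G using (reverse; dis-≤-walk)
    open RemovedNeighbourhood G h v u s dis-uv using (lost⊆; ⊆lost)
    s≤h : s ≤ h
    s≤h = ≤-trans (dis-≤-walk dis-uv (reverse v⇝u)) k≤h
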